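{- Let $r\in\mathbb{N}$ and let $a\in\{0,r\}^d$, $d=n+\binom n2$, satisfy the inequalities (i) $a_{ij}\ge0$, (ii) $a_i-a_{ij}\ge0$, (iv) $a_i+a_{jk}-a_{ij}-a_{ik}\ge0$ for all distinct $i,j,k\in[n]$. Then there exist pairwise vertex-disjoint complete subgraphs $G_1,\dots,G_s$ of $K_n$ with $s\le n$ such that $a=\sum_{t=1}^s r\chi^t$, where $\chi^t\in\{0,1\}^d$ is the characteristic vector of $G_t$.
   Context: Vectors in $\mathbb{R}^d$ are indexed by $[n]\sqcup\binom{[n]}{2}$ (coordinates $a_i$ for vertices, $a_{ij}=a_{ji}$ for edges of $K_n$). The characteristic vector $\chi_H$ of a subgraph $H\subseteq K_n$ has $(\chi_H)_i=1$ iff $i\in V(H)$ and $(\chi_H)_{ij}=1$ iff $ij\in E(H)$, other entries $0$. -}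

module Defs where

open import Data.Nat using (ℕ; zero; suc; _+_; _*_; _≤_)
open import Data.Fin using (Fin; zero; suc)
open import Data.Bool using (Bool; true; false; if_then_else_; _∧_)
open import Data.Product using (_×_)
open import Data.Sum using (_⊎_)
open import Relation.Binary.PropositionalEquality using (_≡_; _≢_)
open import Relation.Nullary using (¬_)

sumFin : (s : ℕ) → (Fin s → ℕ) → ℕ
sumFin zero    f = 0
sumFin (suc s) f = f zero + sumFin s (λ t → f (suc t))

-- A subgraph H of K_n: vertex set V and edge set E (as Boolean indicator
-- functions); E is symmetric and every edge has both ends in V.
-- (Only E i j with i ≢ j is ever used; the diagonal is irrelevant.)
record Subgraph (n : ℕ) : Set where
  field
    V     : Fin n → Bool
    E     : Fin n → Fin n → Bool
    E-sym : ∀ i j → E i j ≡ E j i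
    E-sub : ∀ i j → i ≢ j → E i j ≡ true → V i ≡ true
open Subgraph public

IsComplete : ∀ {n} → Subgraph n → Set
IsComplete H = ∀ i j → i ≢ j → V H i ≡ true → V H j ≡ true → E H i j ≡ true

VertexDisjoint : ∀ {n} → Subgraph n → Subgraph n → Set
VertexDisjoint G H = ∀ i → ¬ (V G i ≡ true × V H i ≡ true)

⟦_⟧ : Bool → ℕ
⟦ b ⟧ = if b then 1 else 0

χv : ∀ {n} → Subgraph n → Fin n → ℕ
χv H i = ⟦ V H i ⟧

χe : ∀ {n} → Subgraph n → Fin n → Fin n → ℕ
χe H i j = ⟦ E H i j ⟧

In0r : ℕ → ℕ → Set
In0r r x = x ≡ 0 ⊎ x ≡ r

{-# OPTIONS --safe #-}
-- The inequalities force the support of a to be a disjoint union of cliques: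
-- (ii) puts every edge of the support on vertices of the support, and if ij and
-- ik are support edges then (iv) gives r + r ≤ a_i + a_jk ≤ r + a_jk, so jk is a
-- support edge too. Hence "equal or joined by a support edge" is an equivalence
-- relation on [n]; its classes, indexed by their least elements, cut the support
-- into at most n vertex-disjoint cliques whose characteristic vectors, scaled by
-- r, sum to a.
module Submission where

open import Defs
open import Level using (Level)
open import Data.Bool using (Bool; true; false; _∧_) renaming (_≟_ to _≟ᵇ_)
open import Data.Bool.Properties using (∧-zeroʳ; ∧-conicalˡ)
open import Data.Fin using (Fin; zero; suc; _≟_)
open import Data.Fin.Properties using (suc-injective)
open import Data.Nat using (ℕ; zero; suc; _+_; _*_; _≤_; z≤n; s≤s)
open import Data.Nat.Properties
  using (+-identityʳ; *-zeroʳ; *-identityʳ; ≤-refl; ≤-trans; +-monoˡ-≤; +-cancelˡ-≤)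
open import Data.Product using (Σ; ∃; _×_; _,_)
open import Data.Sum using (_⊎_; inj₁; inj₂)
open import Function using (_∘_)
open import Relation.Binary.PropositionalEquality using (_≡_; _≢_; refl; sym; trans; cong; cong₂; subst)
open import Relation.Binary.Structures using (IsDecEquivalence)
open import Relation.Nullary using (¬_; Dec; yes; no; does; _because_; ofʸ; contradiction)
open import Relation.Nullary.Decidable using (dec-true; dec-false; _×-dec_; _⊎-dec_; ¬?)
open import Relation.Unary using (Pred; Decidable; _≐_)

dec-true⁻¹ : ∀ {a} {A : Set a} (a? : Dec A) → does a? ≡ true → A
dec-true⁻¹ (true because ofʸ a) _ = a

sumFin-zero : ∀ {s} (f : Fin s → ℕ) → (∀ t → f t ≡ 0) → sumFin s f ≡ 0
sumFin-zero {zero}  f vanish = refl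
sumFin-zero {suc s} f vanish = cong₂ _+_ (vanish zero) (sumFin-zero (f ∘ suc) (vanish ∘ suc))

sumFin-point : ∀ {s} (f : Fin s → ℕ) (c : Fin s) → (∀ t → t ≢ c → f t ≡ 0) → sumFin s f ≡ f c
sumFin-point {suc s} f zero vanish =
  trans (cong (f zero +_) (sumFin-zero (f ∘ suc) (λ t → vanish (suc t) λ ()))) (+-identityʳ (f zero))
sumFin-point {suc s} f (suc c) vanish =
  cong₂ _+_ (vanish zero λ ()) (sumFin-point (f ∘ suc) c (λ t t≢c → vanish (suc t) (t≢c ∘ suc-injective)))

sumFin-select : ∀ {s} (c : Fin s) (b : Bool) (x : ℕ) → sumFin s (λ t → x * ⟦ does (c ≟ t) ∧ b ⟧) ≡ x * ⟦ b ⟧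
sumFin-select c b x =
  trans (sumFin-point (λ t → x * ⟦ does (c ≟ t) ∧ b ⟧) c vanish) (cong (λ d → x * ⟦ d ∧ b ⟧) (dec-true (c ≟ c) refl))
  where
  vanish : ∀ t → t ≢ c → x * ⟦ does (c ≟ t) ∧ b ⟧ ≡ 0
  vanish t t≢c rewrite dec-false (c ≟ t) (t≢c ∘ sym) = *-zeroʳ x

module _ {p : Level} where

  least : ∀ {n} {P : Pred (Fin n) p} → Decidable P → ∃ P → Fin n
  least {suc n} P? w with P? zero
  ... | yes _   = zero
  ... | no ¬P₀ = suc (least (P? ∘ suc) (∃-tail ¬P₀ w))
    where
    ∃-tail : ∀ {P : Pred (Fin (suc n)) p} → ¬ P zero → ∃ P → ∃ (P ∘ suc)
    ∃-tail ¬P₀ (zero  , P₀) = contradiction P₀ ¬P₀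
    ∃-tail ¬P₀ (suc i , Pᵢ) = i , Pᵢ

  least-satisfies : ∀ {n} {P : Pred (Fin n) p} (P? : Decidable P) (w : ∃ P) → P (least P? w)
  least-satisfies {suc n} P? w with P? zero
  ... | yes P₀  = P₀
  ... | no ¬P₀ = least-satisfies (P? ∘ suc) _

  least-cong : ∀ {n} {P Q : Pred (Fin n) p} (P? : Decidable P) (Q? : Decidable Q) (v : ∃ P) (w : ∃ Q) →
               P ≐ Q → least P? v ≡ least Q? w
  least-cong {suc n} P? Q? v w (P⊆Q , Q⊆P) with P? zero | Q? zero
  ... | yes _  | yes _  = refl
  ... | yes P₀ | no ¬Q₀ = contradiction (P⊆Q P₀) ¬Q₀
  ... | no ¬P₀ | yes Q₀ = contradiction (Q⊆P Q₀) ¬P₀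
  ... | no _   | no _   = cong suc (least-cong (P? ∘ suc) (Q? ∘ suc) _ _ (P⊆Q , Q⊆P))

module CanonicalRepresentative {n ℓ} {_≈_ : Fin n → Fin n → Set ℓ} (isDecEquivalence : IsDecEquivalence _≈_) where

  open IsDecEquivalence isDecEquivalence renaming (_≟_ to _≈?_; refl to ≈-refl; sym to ≈-sym; trans to ≈-trans)

  rep : Fin n → Fin n
  rep i = least (_≈? i) (i , ≈-refl)

  rep-≈ : ∀ i → rep i ≈ i
  rep-≈ i = least-satisfies (_≈? i) (i , ≈-refl)

  rep-cong : ∀ {i j} → i ≈ j → rep i ≡ rep j
  rep-cong i≈j = least-cong (_≈? _) (_≈? _) _ _ ((λ k≈i → ≈-trans k≈i i≈j) , (λ k≈j → ≈-trans k≈j (≈-sym i≈j)))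

  rep-injective : ∀ {i j} → rep i ≡ rep j → i ≈ j
  rep-injective {i} {j} rᵢ≡rⱼ = ≈-trans (≈-sym (rep-≈ i)) (subst (_≈ j) (sym rᵢ≡rⱼ) (rep-≈ j))

positive : ℕ → Bool
positive zero    = false
positive (suc _) = true

positive-mono : ∀ {x y} → x ≤ y → positive x ≡ true → positive y ≡ true
positive-mono (s≤s _) _ = refl

In0r⇒≤ : ∀ {r x} → In0r r x → x ≤ r
In0r⇒≤ (inj₁ refl) = z≤n
In0r⇒≤ (inj₂ refl) = ≤-refl

In0r-positive⇒≡ : ∀ {r x} → In0r r x → positive x ≡ true → x ≡ r
In0r-positive⇒≡ (inj₁ refl) ()
In0r-positive⇒≡ (inj₂ x≡r)  _ = x≡r

In0r⇒≡*⟦positive⟧ : ∀ {r x} → In0r r x → x ≡ r * ⟦ positive x ⟧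
In0r⇒≡*⟦positive⟧ {r}     (inj₁ refl) = sym (*-zeroʳ r)
In0r⇒≡*⟦positive⟧ {zero}  (inj₂ refl) = refl
In0r⇒≡*⟦positive⟧ {suc r} (inj₂ refl) = sym (*-identityʳ (suc r))

+-cancelˡ-≤-bounded : ∀ {u v x y} → v ≤ u → u + y ≤ v + x → y ≤ x
+-cancelˡ-≤-bounded {u} {v} {x} {y} v≤u u+y≤v+x = +-cancelˡ-≤ u y x (≤-trans u+y≤v+x (+-monoˡ-≤ x v≤u))

module SupportPartition (n r : ℕ) (av : Fin n → ℕ) (ae : Fin n → Fin n → ℕ)
    (ae-sym   : ∀ i j → ae i j ≡ ae j i)
    (av∈0r    : ∀ i → In0r r (av i))
    (ae∈0r    : ∀ i j → i ≢ j → In0r r (ae i j))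
    (ae≤av    : ∀ i j → i ≢ j → ae i j ≤ av i)
    (triangle : ∀ i j k → i ≢ j → i ≢ k → j ≢ k → ae i j + ae i k ≤ av i + ae j k)
  where

  Adjacent : Fin n → Fin n → Set
  Adjacent i j = i ≢ j × positive (ae i j) ≡ true

  adjacent-sym : ∀ {i j} → Adjacent i j → Adjacent j i
  adjacent-sym {i} {j} (i≢j , pᵢⱼ) = i≢j ∘ sym , subst (λ x → positive x ≡ true) (ae-sym i j) pᵢⱼ

  adjacent-common : ∀ {i j k} → Adjacent i j → Adjacent i k → j ≢ k → Adjacent j k
  adjacent-common {i} {j} {k} (i≢j , pᵢⱼ) (i≢k , pᵢₖ) j≢k =
    j≢k , positive-mono r≤aⱼₖ (subst (λ x → positive x ≡ true) aᵢⱼ≡r pᵢⱼ)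
    where
    aᵢⱼ≡r : ae i j ≡ r
    aᵢⱼ≡r = In0r-positive⇒≡ (ae∈0r i j i≢j) pᵢⱼ
    aᵢₖ≡r : ae i k ≡ r
    aᵢₖ≡r = In0r-positive⇒≡ (ae∈0r i k i≢k) pᵢₖ
    r≤aⱼₖ : r ≤ ae j k
    r≤aⱼₖ = +-cancelˡ-≤-bounded (In0r⇒≤ (av∈0r i))
              (subst (_≤ av i + ae j k) (cong₂ _+_ aᵢⱼ≡r aᵢₖ≡r) (triangle i j k i≢j i≢k j≢k))

  Connected : Fin n → Fin n → Set
  Connected i j = i ≡ j ⊎ Adjacent i j

  connected-isDecEquivalence : IsDecEquivalence Connected
  connected-isDecEquivalence = record
    { isEquivalence = record { refl = inj₁ refl ; sym = connected-sym ; trans = connected-trans }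
    ; _≟_           = λ i j → (i ≟ j) ⊎-dec (¬? (i ≟ j) ×-dec (positive (ae i j) ≟ᵇ true))
    }
    where
    connected-sym : ∀ {i j} → Connected i j → Connected j i
    connected-sym (inj₁ i≡j)   = inj₁ (sym i≡j)
    connected-sym (inj₂ i~j)   = inj₂ (adjacent-sym i~j)

    connected-trans : ∀ {i j k} → Connected i j → Connected j k → Connected i k
    connected-trans (inj₁ refl) j≈k         = j≈k
    connected-trans i≈j         (inj₁ refl) = i≈j
    connected-trans {i} {j} {k} (inj₂ i~j) (inj₂ j~k) with i ≟ k
    ... | yes i≡k = inj₁ i≡k
    ... | no  i≢k = inj₂ (adjacent-common (adjacent-sym i~j) j~k i≢k)

  open CanonicalRepresentative connected-isDecEquivalence

  block : Fin n → Subgraph n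
  block t = record
    { V     = λ i → does (rep i ≟ t) ∧ positive (av i)
    ; E     = λ i j → does (rep i ≟ t) ∧ positive (ae i j)
    ; E-sym = edges-sym
    ; E-sub = edges-sub
    }
    where
    edges-sym : ∀ i j → does (rep i ≟ t) ∧ positive (ae i j) ≡ does (rep j ≟ t) ∧ positive (ae j i)
    edges-sym i j with i ≟ j
    ... | yes refl = refl
    ... | no i≢j rewrite ae-sym j i with positive (ae i j) in pᵢⱼ
    ...   | true  = cong (λ c → does (c ≟ t) ∧ true) (rep-cong (inj₂ (i≢j , pᵢⱼ)))
    ...   | false = trans (∧-zeroʳ _) (sym (∧-zeroʳ _))

    edges-sub : ∀ i j → i ≢ j → does (rep i ≟ t) ∧ positive (ae i j) ≡ true → does (rep i ≟ t) ∧ positive (av i) ≡ true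
    edges-sub i j i≢j with does (rep i ≟ t)
    ... | true  = positive-mono (ae≤av i j i≢j)
    ... | false = λ ()

  V-block⇒rep≡ : ∀ {t i} → V (block t) i ≡ true → rep i ≡ t
  V-block⇒rep≡ {t} {i} i∈t = dec-true⁻¹ (rep i ≟ t) (∧-conicalˡ _ _ i∈t)

  block-complete : ∀ t → IsComplete (block t)
  block-complete t i j i≢j i∈t j∈t with rep-injective (trans (V-block⇒rep≡ i∈t) (sym (V-block⇒rep≡ j∈t)))
  ... | inj₁ i≡j        = contradiction i≡j i≢j
  ... | inj₂ (_ , pᵢⱼ) = cong₂ _∧_ (∧-conicalˡ _ _ i∈t) pᵢⱼ

  blocks-disjoint : ∀ t u → t ≢ u → VertexDisjoint (block t) (block u)
  blocks-disjoint t u t≢u i (i∈t , i∈u) = t≢u (trans (sym (V-block⇒rep≡ i∈t)) (V-block⇒rep≡ i∈u))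

  vertex-sum : ∀ i → av i ≡ sumFin n (λ t → r * χv (block t) i)
  vertex-sum i = trans (In0r⇒≡*⟦positive⟧ (av∈0r i)) (sym (sumFin-select (rep i) (positive (av i)) r))

  edge-sum : ∀ i j → i ≢ j → ae i j ≡ sumFin n (λ t → r * χe (block t) i j)
  edge-sum i j i≢j = trans (In0r⇒≡*⟦positive⟧ (ae∈0r i j i≢j)) (sym (sumFin-select (rep i) (positive (ae i j)) r))

lemma4p1 : (n r : ℕ)
    → (av : Fin n → ℕ) (ae : Fin n → Fin n → ℕ)
    → (∀ i j → ae i j ≡ ae j i)
    → (∀ i → In0r r (av i))
    → (∀ i j → i ≢ j → In0r r (ae i j))
    → (∀ i j → i ≢ j → 0 ≤ ae i j)
    → (∀ i j → i ≢ j → ae i j ≤ av i)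
    → (∀ i j k → i ≢ j → i ≢ k → j ≢ k → ae i j + ae i k ≤ av i + ae j k)
    → Σ ℕ λ s → Σ (Fin s → Subgraph n) λ G →
        s ≤ n
        × (∀ t → IsComplete (G t))
        × (∀ t u → t ≢ u → VertexDisjoint (G t) (G u))
        × (∀ i → av i ≡ sumFin s (λ t → r * χv (G t) i))
        × (∀ i j → i ≢ j → ae i j ≡ sumFin s (λ t → r * χe (G t) i j))
lemma4p1 n r av ae ae-sym av∈0r ae∈0r _ ae≤av triangle =
  n , block , ≤-refl , block-complete , blocks-disjoint , vertex-sum , edge-sum
  where open SupportPartition n r av ae ae-sym av∈0r ae∈0r ae≤av triangle
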